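{- Let $\mathbb{T} = \{ T_n = \tfrac{n(n+1)}{2} : n \ge 1\}$ be the set of positive triangular numbers. If $f$ is a multiplicative function satisfying \[ f(a+b+c) = f(a)+f(b)+f(c) \] for all $a,b,c \in \mathbb{T}$, then $f$ is the identity function, i.e. $f(n)=n$ for all positive integers $n$.
   Context: A multiplicative function is a complex-valued function $f$ on the positive integers, not identically zero, with $f(mn)=f(m)f(n)$ whenever $\gcd(m,n)=1$. -}

module Defs where

open import Level using (Level)
open import Data.Nat using (ℕ; zero; suc; _/_; _≤_)
import Data.Nat as ℕ
open import Data.Nat.Coprimality using (Coprime)
open import Data.Product using (Σ; _×_)
open import Relation.Nullary using (¬_)
open import Algebra.Bundles using (CommutativeRing)

T : ℕ → ℕ
T n = (n ℕ.* suc n) / 2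

module _ {c ℓ : Level} (R : CommutativeRing c ℓ) where
  open CommutativeRing R

  ι : ℕ → Carrier
  ι zero    = 0#
  ι (suc n) = 1# + ι n

  IsField : Set (c Level.⊔ ℓ)
  IsField = (¬ (1# ≈ 0#)) ×
            ((x : Carrier) → ¬ (x ≈ 0#) → Σ Carrier (λ y → (x * y) ≈ 1#))

  CharZero : Set ℓ
  CharZero = (n : ℕ) → ¬ (ι (suc n) ≈ 0#)

  -- f is multiplicative on the positive integers (values at 0 are irrelevant)
  Multiplicative : (ℕ → Carrier) → Set ℓ
  Multiplicative f =
    (Σ ℕ (λ n → (1 ≤ n) × ¬ (f n ≈ 0#))) ×
    ((m n : ℕ) → 1 ≤ m → 1 ≤ n → Coprime m n → f (m ℕ.* n) ≈ (f m * f n))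

-- Say f is fixed at n when f(n) = ι n.  Multiplicativity gives f(1) = 1, and
-- fixed points are closed under coprime products and coprime cofactors (from
-- f fixed at d and n·d infer f fixed at n: ι d is invertible since R is a
-- field of characteristic zero).  Additivity fixes f at T a + T b + T c once it
-- is fixed at T a, T b, T c, and T a = a(a+1)/2 splits into coprime factors
-- below a + 2.  The purely arithmetic lemma 'reduction' shows every n ≥ 1 is a
-- base case 1, 2, 3, 4, a coprime product u·v with u, v ≥ 2, or has a
-- triangular certificate n·d = T a + T b + T c with gcd(n, d) = 1 and
-- d, a + 1, b + 1, c + 1 < n, coming from (according to n mod 3)
--   (3m+1)·m = T(m-1) + T m + T(2m),  (3m+2)·(m+1) = T m + T(m+1) + T(2m+1),
--   9m·(6m+1) = 3·T(6m),  and  3k = 3·k with 3 ∤ k.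
-- Strong induction on n then proves the theorem; the base case 2 uses
-- f(2)·f(5) = f(10) = f(T 1 + T 2 + T 3) = 4 + f(2)·3.
module Submission where

open import Defs
open import Level using (Level)
open import Data.Nat using (ℕ; zero; suc; _+_; _*_; _≤_; _<_; z≤n; s≤s)
import Data.Nat.Properties as ℕₚ
open ℕₚ using (*-suc; *-distribʳ-+; *-cancelʳ-≡; m≤m+n; m<m*n; n<1+n; <-trans; ≤-trans; <⇒≤)
open import Data.Nat.DivMod using (m/n*n≡m)
open import Data.Nat.Divisibility using (_∣_; ∣1⇒≡1; ∣m+n∣m⇒∣n; ∣n⇒∣m*n; ∣m⇒∣m*n; m∣m*n)
import Data.Nat.Coprimality as Coprimality
open Coprimality using (Coprime)
open import Data.Nat.Induction using (<-rec)
open import Data.Nat.Tactic.RingSolver using (solve-∀)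
open import Data.Product using (Σ; _×_; _,_; proj₁; proj₂)
import Relation.Binary.PropositionalEquality as ≡
open ≡ using (_≡_; cong; cong₂; subst)
open import Algebra.Bundles using (CommutativeRing)

data Parity : ℕ → Set where
  even : ∀ b → Parity (2 * b)
  odd  : ∀ b → Parity (suc (2 * b))

parity : ∀ n → Parity n
parity zero = even 0
parity (suc n) with parity n
... | even b = odd b
... | odd b  = subst Parity (*-suc 2 b) (even (suc b))

data Mod3 : ℕ → Set where
  ≡0 : ∀ k → Mod3 (3 * k)
  ≡1 : ∀ k → Mod3 (suc (3 * k))
  ≡2 : ∀ k → Mod3 (suc (suc (3 * k)))

mod3 : ∀ n → Mod3 n
mod3 zero = ≡0 0
mod3 (suc n) with mod3 n
... | ≡0 k = ≡1 k
... | ≡1 k = ≡2 k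
... | ≡2 k = subst Mod3 (*-suc 3 k) (≡0 (suc k))

<-by : ∀ {x y} k → suc x + k ≡ y → x < y
<-by {x} k eq = subst (x <_) eq (m≤m+n (suc x) k)

bézout⇒coprime : ∀ {a b} x y → x * a ≡ y * b + 1 → Coprime a b
bézout⇒coprime x y eq {i} (i∣a , i∣b) =
  ∣1⇒≡1 (∣m+n∣m⇒∣n (subst (i ∣_) eq (∣n⇒∣m*n x i∣a)) (∣n⇒∣m*n y i∣b))

-- The product a(a+1) is even, so T a = a(a+1)/2 is an exact half.
2∣pronic : ∀ a → 2 ∣ a * suc a
2∣pronic a with parity a
... | even b = ∣m⇒∣m*n (suc (2 * b)) (m∣m*n b)
... | odd b  = ∣n⇒∣m*n (suc (2 * b)) (subst (2 ∣_) (*-suc 2 b) (m∣m*n (suc b)))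

double-T : ∀ a → T a * 2 ≡ a * suc a
double-T a = m/n*n≡m (2∣pronic a)

-- Identities between triangular numbers can be checked after doubling.
T-halve : ∀ a N → a * suc a ≡ N * 2 → T a ≡ N
T-halve a N eq = *-cancelʳ-≡ _ _ 2 (≡.trans (double-T a) eq)

T-sum : ∀ a b c N → a * suc a + b * suc b + c * suc c ≡ N * 2 → T a + T b + T c ≡ N
T-sum a b c N eq = *-cancelʳ-≡ _ _ 2 (begin
  (T a + T b + T c) * 2              ≡⟨ *-distribʳ-+ 2 (T a + T b) (T c) ⟩
  (T a + T b) * 2 + T c * 2          ≡⟨ cong (_+ T c * 2) (*-distribʳ-+ 2 (T a) (T b)) ⟩
  T a * 2 + T b * 2 + T c * 2        ≡⟨ cong₂ _+_ (cong₂ _+_ (double-T a) (double-T b)) (double-T c) ⟩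
  a * suc a + b * suc b + c * suc c  ≡⟨ eq ⟩
  N * 2                              ∎)
  where open ≡.≡-Reasoning

T-even : ∀ b → T (2 * b) ≡ b * suc (2 * b)
T-even b = T-halve (2 * b) _ (doubled b)
  where
  doubled : ∀ b → 2 * b * suc (2 * b) ≡ b * suc (2 * b) * 2
  doubled = solve-∀

T-odd : ∀ b → T (suc (2 * b)) ≡ suc (2 * b) * suc b
T-odd b = T-halve (suc (2 * b)) _ (doubled b)
  where
  doubled : ∀ b → suc (2 * b) * suc (suc (2 * b)) ≡ suc (2 * b) * suc b * 2
  doubled = solve-∀

coprime-T-even : ∀ b → Coprime b (suc (2 * b))
coprime-T-even b = Coprimality.sym (bézout⇒coprime 1 2 (bézout b))
  where
  bézout : ∀ b → 1 * suc (2 * b) ≡ 2 * b + 1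
  bézout = solve-∀

coprime-T-odd : ∀ b → Coprime (suc (2 * b)) (suc b)
coprime-T-odd b = Coprimality.sym (bézout⇒coprime 2 1 (bézout b))
  where
  bézout : ∀ b → 2 * suc b ≡ 1 * suc (2 * b) + 1
  bézout = solve-∀

-- Indices a ≥ 1 whose T a factors into coprime numbers below n.
InRange : ℕ → ℕ → Set
InRange n a = 1 ≤ a × suc a < n

record Certificate (n : ℕ) : Set where
  field
    d a b c : ℕ
    sum     : T a + T b + T c ≡ n * d
    coprime : Coprime n d
    d-range : 1 ≤ d × d < n
    a-range : InRange n a
    b-range : InRange n b
    c-range : InRange n c

factors-< : ∀ {u v} → 2 ≤ u → 2 ≤ v → u < u * v × v < u * v
factors-< {u} {v} 2≤u@(s≤s _) 2≤v@(s≤s _) =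
  m<m*n u v 2≤v , subst (v <_) (ℕₚ.*-comm v u) (m<m*n v u 2≤u)

data Reduction : ℕ → Set where
  one   : Reduction 1
  two   : Reduction 2
  three : Reduction 3
  four  : Reduction 4
  split      : ∀ u v → 2 ≤ u → 2 ≤ v → Coprime u v → Reduction (u * v)
  triangular : ∀ {n} → Certificate n → Reduction n

-- (3m+1)·m = T(m-1) + T m + T(2m), here for m = p + 2.
certificate-≡1 : ∀ p → Certificate (suc (3 * suc (suc p)))
certificate-≡1 p = record
  { d = suc (suc p) ; a = suc p ; b = suc (suc p) ; c = 2 * suc (suc p)
  ; sum     = T-sum (suc p) (suc (suc p)) (2 * suc (suc p)) _ (doubled p)
  ; coprime = bézout⇒coprime 1 3 (bézout p)
  ; d-range = s≤s z≤n , d<n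
  ; a-range = s≤s z≤n , d<n
  ; b-range = s≤s z≤n , b+1<n
  ; c-range = s≤s z≤n , <-by (suc p) (c-gap p)
  }
  where
  doubled : ∀ p → let m = suc (suc p) in
    suc p * m + m * suc m + 2 * m * suc (2 * m) ≡ suc (3 * m) * m * 2
  doubled = solve-∀
  bézout : ∀ p → let m = suc (suc p) in 1 * suc (3 * m) ≡ 3 * m + 1
  bézout = solve-∀
  b-gap : ∀ p → let m = suc (suc p) in suc (suc m) + suc (2 * suc p) ≡ suc (3 * m)
  b-gap = solve-∀
  c-gap : ∀ p → let m = suc (suc p) in suc (suc (2 * m)) + suc p ≡ suc (3 * m)
  c-gap = solve-∀
  b+1<n : suc (suc (suc p)) < suc (3 * suc (suc p))
  b+1<n = <-by (suc (2 * suc p)) (b-gap p)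
  d<n : suc (suc p) < suc (3 * suc (suc p))
  d<n = <-trans (n<1+n _) b+1<n

-- (3m+2)·(m+1) = T m + T(m+1) + T(2m+1), here for m = k + 1.
certificate-≡2 : ∀ k → Certificate (suc (suc (3 * suc k)))
certificate-≡2 k = record
  { d = suc (suc k) ; a = suc k ; b = suc (suc k) ; c = suc (2 * suc k)
  ; sum     = T-sum (suc k) (suc (suc k)) (suc (2 * suc k)) _ (doubled k)
  ; coprime = Coprimality.sym (bézout⇒coprime 3 1 (bézout k))
  ; d-range = s≤s z≤n , d<n
  ; a-range = s≤s z≤n , d<n
  ; b-range = s≤s z≤n , d+1<n
  ; c-range = s≤s z≤n , <-by k (c-gap k)
  }
  where
  doubled : ∀ k → let m = suc k in
    m * suc m + suc m * suc (suc m) + suc (2 * m) * suc (suc (2 * m))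
      ≡ suc (suc (3 * m)) * suc m * 2
  doubled = solve-∀
  bézout : ∀ k → let m = suc k in 3 * suc m ≡ 1 * suc (suc (3 * m)) + 1
  bézout = solve-∀
  d-gap : ∀ k → let m = suc k in suc (suc (suc m)) + suc (2 * k) ≡ suc (suc (3 * m))
  d-gap = solve-∀
  c-gap : ∀ k → let m = suc k in suc (suc (suc (2 * m))) + k ≡ suc (suc (3 * m))
  c-gap = solve-∀
  d+1<n : suc (suc (suc k)) < suc (suc (3 * suc k))
  d+1<n = <-by (suc (2 * k)) (d-gap k)
  d<n : suc (suc k) < suc (suc (3 * suc k))
  d<n = <-trans (n<1+n _) d+1<n

-- 9m·(6m+1) = T(6m) + T(6m) + T(6m), here for m = j + 1.
certificate-≡0 : ∀ j → Certificate (3 * (3 * suc j))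
certificate-≡0 j = record
  { d = suc (6 * suc j) ; a = 6 * suc j ; b = 6 * suc j ; c = 6 * suc j
  ; sum     = T-sum (6 * suc j) (6 * suc j) (6 * suc j) _ (doubled j)
  ; coprime = Coprimality.sym (bézout⇒coprime (suc (3 * suc j)) (suc (2 * suc j)) (bézout j))
  ; d-range = s≤s z≤n , d<n
  ; a-range = s≤s z≤n , d<n
  ; b-range = s≤s z≤n , d<n
  ; c-range = s≤s z≤n , d<n
  }
  where
  doubled : ∀ j → let m = suc j in
    6 * m * suc (6 * m) + 6 * m * suc (6 * m) + 6 * m * suc (6 * m)
      ≡ 3 * (3 * m) * suc (6 * m) * 2
  doubled = solve-∀
  bézout : ∀ j → let m = suc j in
    suc (3 * m) * suc (6 * m) ≡ suc (2 * m) * (3 * (3 * m)) + 1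
  bézout = solve-∀
  d-gap : ∀ j → let m = suc j in suc (suc (6 * m)) + suc (3 * j) ≡ 3 * (3 * m)
  d-gap = solve-∀
  d<n : suc (6 * suc j) < 3 * (3 * suc j)
  d<n = <-by (suc (3 * j)) (d-gap j)

coprime-3-≡1 : ∀ j → Coprime 3 (suc (3 * j))
coprime-3-≡1 j = Coprimality.sym (bézout⇒coprime 1 j (bézout j))
  where
  bézout : ∀ j → 1 * suc (3 * j) ≡ j * 3 + 1
  bézout = solve-∀

coprime-3-≡2 : ∀ j → Coprime 3 (suc (suc (3 * j)))
coprime-3-≡2 j = bézout⇒coprime (suc j) 1 (bézout j)
  where
  bézout : ∀ j → suc j * 3 ≡ 1 * suc (suc (3 * j)) + 1
  bézout = solve-∀

reduction : ∀ n → 1 ≤ n → Reduction n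
reduction n = by-residue (mod3 n)
  where
  2≤ : ∀ {n} → 2 ≤ suc (suc n)
  2≤ = s≤s (s≤s z≤n)

  multiple-of-3 : ∀ {k} → Mod3 k → 1 ≤ 3 * k → Reduction (3 * k)
  multiple-of-3 (≡0 zero)    ()
  multiple-of-3 (≡0 (suc j)) _ = triangular (certificate-≡0 j)
  multiple-of-3 (≡1 zero)    _ = three
  multiple-of-3 (≡1 (suc j)) _ = split 3 _ 2≤ 2≤ (coprime-3-≡1 (suc j))
  multiple-of-3 (≡2 j)       _ = split 3 _ 2≤ 2≤ (coprime-3-≡2 j)

  by-residue : ∀ {n} → Mod3 n → 1 ≤ n → Reduction n
  by-residue (≡0 k)             1≤n = multiple-of-3 (mod3 k) 1≤n
  by-residue (≡1 zero)          _   = one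
  by-residue (≡1 (suc zero))    _   = four
  by-residue (≡1 (suc (suc p))) _   = triangular (certificate-≡1 p)
  by-residue (≡2 zero)          _   = two
  by-residue (≡2 (suc k))       _   = triangular (certificate-≡2 k)

module RingFacts {r ℓ : Level} (R : CommutativeRing r ℓ) where
  open CommutativeRing R renaming (_+_ to infixl 6 _+ᴿ_; _*_ to infixl 7 _*ᴿ_) hiding (zero)
  open import Relation.Binary.Reasoning.Setoid setoid

  ι-1 : ι R 1 ≈ 1#
  ι-1 = +-identityʳ 1#

  ι-+ : ∀ m n → ι R (m + n) ≈ ι R m +ᴿ ι R n
  ι-+ zero    n = sym (+-identityˡ _)
  ι-+ (suc m) n = trans (+-congˡ (ι-+ m n)) (sym (+-assoc _ _ _))

  ι-* : ∀ m n → ι R (m * n) ≈ ι R m *ᴿ ι R n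
  ι-* zero    n = sym (zeroˡ _)
  ι-* (suc m) n = begin
    ι R (n + m * n)                   ≈⟨ ι-+ n (m * n) ⟩
    ι R n +ᴿ ι R (m * n)              ≈⟨ +-cong (sym (*-identityˡ _)) (ι-* m n) ⟩
    1# *ᴿ ι R n +ᴿ ι R m *ᴿ ι R n     ≈⟨ distribʳ _ _ _ ⟨
    (1# +ᴿ ι R m) *ᴿ ι R n            ∎

  cancel-invertibleʳ : ∀ {u x y} → Σ Carrier (λ v → u *ᴿ v ≈ 1#) → x *ᴿ u ≈ y *ᴿ u → x ≈ y
  cancel-invertibleʳ {u} {x} {y} (v , u*v≈1) x*u≈y*u = begin
    x               ≈⟨ *-identityʳ x ⟨
    x *ᴿ 1#         ≈⟨ *-congˡ u*v≈1 ⟨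
    x *ᴿ (u *ᴿ v)   ≈⟨ *-assoc x u v ⟨
    x *ᴿ u *ᴿ v     ≈⟨ *-congʳ x*u≈y*u ⟩
    y *ᴿ u *ᴿ v     ≈⟨ *-assoc y u v ⟩
    y *ᴿ (u *ᴿ v)   ≈⟨ *-congˡ u*v≈1 ⟩
    y *ᴿ 1#         ≈⟨ *-identityʳ y ⟩
    y               ∎

module Proof {r ℓ : Level} (R : CommutativeRing r ℓ)
  (isField : IsField R) (charZero : CharZero R)
  (f : ℕ → CommutativeRing.Carrier R) (multiplicative : Multiplicative R f)
  (additive : (a b c : ℕ) → 1 ≤ a → 1 ≤ b → 1 ≤ c →
    CommutativeRing._≈_ R (f (T a + T b + T c))
      (CommutativeRing._+_ R (CommutativeRing._+_ R (f (T a)) (f (T b))) (f (T c))))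
  where
  open CommutativeRing R renaming (_+_ to infixl 6 _+ᴿ_; _*_ to infixl 7 _*ᴿ_) hiding (zero)
  open import Algebra.Properties.Ring ring using (+-cancelʳ)
  open import Relation.Binary.Reasoning.Setoid setoid
  open RingFacts R

  Fixed : ℕ → Set ℓ
  Fixed n = f n ≈ ι R n

  1≤ : ∀ {n} → 1 ≤ suc n
  1≤ = s≤s z≤n

  fixed-≡ : ∀ {m n} → m ≡ n → Fixed m → Fixed n
  fixed-≡ ≡.refl fixed = fixed

  f-* : ∀ {m n} → 1 ≤ m → 1 ≤ n → Coprime m n → f (m * n) ≈ f m *ᴿ f n
  f-* = proj₂ multiplicative _ _

  -- Positive naturals can be cancelled in R: it is a field of characteristic zero.
  cancel-ι : ∀ {x} n d → x *ᴿ ι R (suc d) ≈ ι R (n * suc d) → x ≈ ι R n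
  cancel-ι n d eq =
    cancel-invertibleʳ (proj₂ isField _ (charZero d)) (trans eq (ι-* n (suc d)))

  -- f(1) acts as a unit on every value of f, in particular on a nonzero one.
  f-1-unit : ∀ {n} → 1 ≤ n → f 1 *ᴿ f n ≈ 1# *ᴿ f n
  f-1-unit {n} 1≤n = begin
    f 1 *ᴿ f n    ≈⟨ *-comm _ _ ⟩
    f n *ᴿ f 1    ≈⟨ f-* 1≤n 1≤ (Coprimality.sym (Coprimality.1-coprimeTo n)) ⟨
    f (n * 1)     ≈⟨ reflexive (cong f (ℕₚ.*-identityʳ n)) ⟩
    f n           ≈⟨ *-identityˡ _ ⟨
    1# *ᴿ f n     ∎

  fixed-1 : Fixed 1
  fixed-1 =
    let (n₀ , 1≤n₀ , f-n₀≉0) = proj₁ multiplicative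
    in trans (cancel-invertibleʳ (proj₂ isField (f n₀) f-n₀≉0) (f-1-unit 1≤n₀)) (sym ι-1)

  fixed-* : ∀ {u v} → 1 ≤ u → 1 ≤ v → Coprime u v → Fixed u → Fixed v → Fixed (u * v)
  fixed-* {u} {v} 1≤u 1≤v coprime fixed-u fixed-v = begin
    f (u * v)          ≈⟨ f-* 1≤u 1≤v coprime ⟩
    f u *ᴿ f v         ≈⟨ *-cong fixed-u fixed-v ⟩
    ι R u *ᴿ ι R v     ≈⟨ ι-* u v ⟨
    ι R (u * v)        ∎

  fixed-cofactor : ∀ {n d} → 1 ≤ n → 1 ≤ d → Coprime n d → Fixed d → Fixed (n * d) → Fixed n
  fixed-cofactor {n} {suc d} 1≤n 1≤d coprime fixed-d fixed-nd = cancel-ι n d (begin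
    f n *ᴿ ι R (suc d)    ≈⟨ *-congˡ fixed-d ⟨
    f n *ᴿ f (suc d)      ≈⟨ f-* 1≤n 1≤d coprime ⟨
    f (n * suc d)         ≈⟨ fixed-nd ⟩
    ι R (n * suc d)       ∎)

  fixed-T-sum : ∀ a b c → 1 ≤ a → 1 ≤ b → 1 ≤ c →
    Fixed (T a) → Fixed (T b) → Fixed (T c) → Fixed (T a + T b + T c)
  fixed-T-sum a b c 1≤a 1≤b 1≤c fixed-a fixed-b fixed-c = begin
    f (T a + T b + T c)                    ≈⟨ additive a b c 1≤a 1≤b 1≤c ⟩
    f (T a) +ᴿ f (T b) +ᴿ f (T c)          ≈⟨ +-cong (+-cong fixed-a fixed-b) fixed-c ⟩
    ι R (T a) +ᴿ ι R (T b) +ᴿ ι R (T c)    ≈⟨ +-congʳ (ι-+ (T a) (T b)) ⟨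
    ι R (T a + T b) +ᴿ ι R (T c)           ≈⟨ ι-+ (T a + T b) (T c) ⟨
    ι R (T a + T b + T c)                  ∎

  -- Base cases: 3 = T 1 + T 1 + T 1 and 5 = T 1 + T 1 + T 2; 2 from the linear
  -- relation f(2)·5 = f(10) = f(T 1 + T 2 + T 3) = 4 + f(2)·3; 4·3 = T 2 + T 2 + T 3.

  fixed-3 : Fixed 3
  fixed-3 = fixed-T-sum 1 1 1 1≤ 1≤ 1≤ fixed-1 fixed-1 fixed-1

  fixed-5 : Fixed 5
  fixed-5 = fixed-T-sum 1 1 2 1≤ 1≤ 1≤ fixed-1 fixed-1 fixed-3

  fixed-2 : Fixed 2
  fixed-2 = cancel-ι 2 1 (+-cancelʳ (f 2 *ᴿ ι R 3) _ _ (begin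
    f 2 *ᴿ ι R 2 +ᴿ f 2 *ᴿ ι R 3     ≈⟨ distribˡ _ _ _ ⟨
    f 2 *ᴿ (ι R 2 +ᴿ ι R 3)          ≈⟨ *-congˡ (ι-+ 2 3) ⟨
    f 2 *ᴿ ι R 5                     ≈⟨ *-congˡ fixed-5 ⟨
    f 2 *ᴿ f 5                       ≈⟨ f-* 1≤ 1≤ (bézout⇒coprime 3 1 ≡.refl) ⟨
    f 10                             ≈⟨ additive 1 2 3 1≤ 1≤ 1≤ ⟩
    f 1 +ᴿ f 3 +ᴿ f 6                ≈⟨ +-cong (+-cong fixed-1 fixed-3) (f-* 1≤ 1≤ (bézout⇒coprime 2 1 ≡.refl)) ⟩
    ι R 1 +ᴿ ι R 3 +ᴿ f 2 *ᴿ f 3     ≈⟨ +-congʳ (ι-+ 1 3) ⟨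
    ι R 4 +ᴿ f 2 *ᴿ f 3              ≈⟨ +-congˡ (*-congˡ fixed-3) ⟩
    ι R 4 +ᴿ f 2 *ᴿ ι R 3            ∎))

  fixed-4 : Fixed 4
  fixed-4 = fixed-cofactor 1≤ 1≤ (bézout⇒coprime 1 1 ≡.refl) fixed-3
    (fixed-T-sum 2 2 3 1≤ 1≤ 1≤ fixed-3 fixed-3 (fixed-* 1≤ 1≤ (bézout⇒coprime 2 1 ≡.refl) fixed-2 fixed-3))

  FixedBelow : ℕ → Set ℓ
  FixedBelow n = ∀ {m} → m < n → 1 ≤ m → Fixed m

  -- Below n, f is fixed at T a for indices in range, as T a splits into coprime factors.
  fixed-T : ∀ {n} → FixedBelow n → ∀ {a} → InRange n a → Fixed (T a)
  fixed-T {n} below {a} (1≤a , a+1<n) = by-parity (parity a) 1≤a a+1<n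
    where
    by-parity : ∀ {a} → Parity a → 1 ≤ a → suc a < n → Fixed (T a)
    by-parity (even zero)    ()
    by-parity (even (suc b)) _ a+1<n = fixed-≡ (≡.sym (T-even (suc b)))
      (fixed-* 1≤ 1≤ (coprime-T-even (suc b))
        (below (≤-trans (s≤s (m≤m+n (suc b) _)) (<⇒≤ a+1<n)) 1≤)
        (below a+1<n 1≤))
    by-parity (odd b)        _ a+1<n = fixed-≡ (≡.sym (T-odd b))
      (fixed-* 1≤ 1≤ (coprime-T-odd b)
        (below (<-trans (n<1+n _) a+1<n) 1≤)
        (below (≤-trans (s≤s (s≤s (m≤m+n b _))) (<⇒≤ a+1<n)) 1≤))

  fixed-by-reduction : ∀ {n} → FixedBelow n → Reduction n → Fixed n
  fixed-by-reduction _ one   = fixed-1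
  fixed-by-reduction _ two   = fixed-2
  fixed-by-reduction _ three = fixed-3
  fixed-by-reduction _ four  = fixed-4
  fixed-by-reduction below (split u v 2≤u 2≤v coprime) =
    let (u<uv , v<uv) = factors-< 2≤u 2≤v
    in fixed-* (<⇒≤ 2≤u) (<⇒≤ 2≤v) coprime (below u<uv (<⇒≤ 2≤u)) (below v<uv (<⇒≤ 2≤v))
  fixed-by-reduction {n} below (triangular certificate) =
    fixed-cofactor (≤-trans 1≤d (<⇒≤ d<n)) 1≤d coprime (below d<n 1≤d)
      (fixed-≡ sum (fixed-T-sum a b c (proj₁ a-range) (proj₁ b-range) (proj₁ c-range)
        (fixed-T below a-range) (fixed-T below b-range) (fixed-T below c-range)))
    where
    open Certificate certificate
    1≤d : 1 ≤ d
    1≤d = proj₁ d-range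
    d<n : d < n
    d<n = proj₂ d-range

  fixed : ∀ n → 1 ≤ n → Fixed n
  fixed = <-rec (λ n → 1 ≤ n → Fixed n)
    (λ n below 1≤n → fixed-by-reduction below (reduction n 1≤n))

theorem2p1 : {c ℓ : Level} (R : CommutativeRing c ℓ) →
    IsField R → CharZero R →
    (f : ℕ → CommutativeRing.Carrier R) →
    Multiplicative R f →
    ((a b c : ℕ) → 1 ≤ a → 1 ≤ b → 1 ≤ c →
      CommutativeRing._≈_ R (f (T a + T b + T c))
        (CommutativeRing._+_ R (CommutativeRing._+_ R (f (T a)) (f (T b))) (f (T c)))) →
    (n : ℕ) → 1 ≤ n → CommutativeRing._≈_ R (f n) (ι R n)
theorem2p1 R isField charZero f multiplicative additive =
  Proof.fixed R isField charZero f multiplicative additive
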